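{- Let $p=3$, $k=1$, $e\ge1$, and $n=3^{l_1}+3^{l_2}+3^{l_3}$ where $l_1,l_2,l_3$ are non-negative integers, exactly one of which is zero. Then $D_{n,1}(1,x)$ is not a permutation polynomial of $\mathbb{F}_{3^e}$.
   Context: For an odd prime $p$ and $0\le k\le p-1$: for $n\ge 1$, $D_{n,k}(1,x)=\sum_{i=0}^{\lfloor n/2\rfloor}\frac{n-ki}{n-i}\binom{n-i}{i}(-x)^i$, where the coefficient is the integer $\binom{n-i}{i}-(k-1)\binom{n-i-1}{i-1}$ (with $\binom{m}{ -1}=0$) viewed in $\mathbb{F}_p$; $D_{0,k}(1,x)=2-k$. Equivalently $D_{1,k}=1$ and $D_{n,k}=D_{n-1,k}-xD_{n-2,k}$ for $n\ge2$. A polynomial over $\mathbb{F}_q$ is a permutation polynomial of $\mathbb{F}_q$ if it induces a bijection of $\mathbb{F}_q$. -}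

module Defs where

open import Data.Nat as ℕ using (ℕ; zero; suc; _∸_; _/_)
open import Data.Nat.Combinatorics using (_C_)
open import Data.Integer as ℤ using (ℤ; +_; -[1+_])
open import Data.Fin using (Fin)
open import Data.List using (List; upTo; map; foldr)
open import Relation.Binary.PropositionalEquality using (_≡_)
open import Relation.Nullary using (¬_)
open import Data.Product using (∃)
open import Data.Sum using (_⊎_)
open import Data.Product using (_×_)
open import Algebra.Structures using (IsCommutativeRing)
open import Function.Bundles using (_↔_)
open import Function.Definitions using (Bijective)

record FiniteField (q : ℕ) : Set₁ where
  field
    Carrier : Set
    _+_ _*_ : Carrier → Carrier → Carrier
    -_ : Carrier → Carrier
    0# 1# : Carrier
    isCommutativeRing : IsCommutativeRing _≡_ _+_ _*_ -_ 0# 1#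
    0≢1 : ¬ (0# ≡ 1#)
    inverse : ∀ x → ¬ (x ≡ 0#) → ∃ λ y → (x * y) ≡ 1#
    enumeration : Carrier ↔ Fin q

module _ {q : ℕ} (F : FiniteField q) where
  open FiniteField F

  ℕ→F : ℕ → Carrier
  ℕ→F zero = 0#
  ℕ→F (suc n) = 1# + ℕ→F n

  ℤ→F : ℤ → Carrier
  ℤ→F (+ n) = ℕ→F n
  ℤ→F -[1+ n ] = - ℕ→F (suc n)

  pow : Carrier → ℕ → Carrier
  pow x zero = 1#
  pow x (suc i) = x * pow x i

  -- integer coefficient  binom(n-i,i) - (k-1) binom(n-i-1,i-1)   (binom(m,-1) = 0)
  coeff : ℕ → ℕ → ℕ → ℤ
  coeff n k zero = + 1
  coeff n k (suc j) =
    (+ ((n ∸ suc j) C suc j)) ℤ.- ((+ k ℤ.- + 1) ℤ.* (+ ((n ∸ suc j ∸ 1) C j)))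

  D : ℕ → ℕ → Carrier → Carrier
  D zero k x = ℤ→F (+ 2 ℤ.- + k)
  D n@(suc _) k x =
    foldr _+_ 0# (map (λ i → ℤ→F (coeff n k i) * pow (- x) i) (upTo (suc (n / 2))))

  IsPermutation : (Carrier → Carrier) → Set
  IsPermutation f = Bijective _≡_ _≡_ f

ExactlyOneZero : ℕ → ℕ → ℕ → Set
ExactlyOneZero a b c =
    (a ≡ 0 × ¬ (b ≡ 0) × ¬ (c ≡ 0))
  ⊎ (¬ (a ≡ 0) × b ≡ 0 × ¬ (c ≡ 0))
  ⊎ (¬ (a ≡ 0) × ¬ (b ≡ 0) × c ≡ 0)

module Submission where

open import Defs
open import Data.Nat using (ℕ; _+_; _^_; _≤_)
open import Relation.Nullary using (¬_)

open import Data.Nat using (zero; suc; _*_; _∸_; _/_; _%_; _<_; z≤n; s≤s)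
import Data.Nat.Properties as ℕP
open import Data.Nat.DivMod using (m≡m%n+[m/n]*n; m%n<n; m/n≤m)
open import Data.Nat.Combinatorics using (_C_; nCk+nC[k+1]≡[n+1]C[k+1]; k>n⇒nCk≡0)
open import Data.Nat.Tactic.RingSolver using (solve-∀)
import Data.Integer as ℤ
import Data.Integer.Properties as ℤP
open import Data.List using (applyUpTo; map; foldr)
open import Data.Product using (∃; _,_)
open import Data.Sum using (inj₁; inj₂)
open import Data.Empty using (⊥-elim)
open import Relation.Binary.PropositionalEquality
  using (_≡_; refl; sym; trans; cong; cong₂; module ≡-Reasoning)
open import Algebra.Bundles using (AbelianGroup; CommutativeRing)
open import Function using (_∘_)
open import Level using (0ℓ)

-- For k = 1 the coefficient of D_{n,1}(1,x) is the
-- binomial coefficient C(n-i,i), so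
--     D_{n,1}(1,0) = 1   and   D_{n,1}(1,1) = E n := Σ_i (-1)^i C(n-i,i).
-- Pascal's rule gives E (n+2) = E (n+1) - E n in any ring, hence
-- E (n+3) = - E n and E has period 6; since E 1 = 1 we get E n = 1 whenever
-- n ≡ 1 (mod 6).  Finally 3^l ≡ 3 (mod 6) for l ≥ 1, so when exactly one of
-- l₁, l₂, l₃ vanishes, n = 3^l₁ + 3^l₂ + 3^l₃ ≡ 1 + 3 + 3 ≡ 1 (mod 6).
-- Then D_{n,1}(1,x) takes the value 1 at both 0 and 1, so it is not
-- injective on F.

pascal-diagonal : ∀ n i k → i ≤ k → (suc n ∸ i) C suc k ≡ (n ∸ i) C k + (n ∸ i) C suc k
pascal-diagonal n       zero    k       _ = sym (nCk+nC[k+1]≡[n+1]C[k+1] n k)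
pascal-diagonal zero    (suc i) (suc k) _ rewrite ℕP.0∸n≡0 i = refl
pascal-diagonal (suc n) (suc i) k i≤k =
  pascal-diagonal n i k (ℕP.≤-trans (ℕP.n≤1+n i) i≤k)

-- Beyond the middle index the diagonal coefficient C(n-i,i) is zero,
-- because n - i < i as soon as i > n/2.
beyond-half : ∀ n i → n / 2 < i → n ∸ i < i
beyond-half n (suc i) half<i = ℕP.m<n+o⇒m∸n<o n (suc i) n<2i
  where
  open ℕP.≤-Reasoning
  k = n / 2
  double : ∀ k → k * 2 ≡ k + k
  double = solve-∀
  n<2i : n < suc i + suc i
  n<2i = begin-strict
    n                   ≡⟨ m≡m%n+[m/n]*n n 2 ⟩
    n % 2 + k * 2       ≡⟨ cong (n % 2 +_) (double k) ⟩
    n % 2 + (k + k)     ≤⟨ ℕP.+-monoˡ-≤ (k + k) (ℕP.≤-pred (m%n<n n 2)) ⟩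
    suc (k + k)         <⟨ s≤s (ℕP.+-monoʳ-< k (ℕP.n<1+n k)) ⟩
    suc (k + suc k)     ≤⟨ ℕP.+-mono-≤ half<i half<i ⟩
    suc i + suc i       ∎

ThreeMod6 : ℕ → Set
ThreeMod6 n = ∃ λ r → n ≡ 3 + 6 * r

OneMod6 : ℕ → Set
OneMod6 n = ∃ λ q → n ≡ suc (q * 6)

pow3≡3mod6 : ∀ l → ¬ (l ≡ 0) → ThreeMod6 (3 ^ l)
pow3≡3mod6 zero          l≢0 = ⊥-elim (l≢0 refl)
pow3≡3mod6 (suc zero)    _   = 0 , refl
pow3≡3mod6 (suc (suc l)) _   with pow3≡3mod6 (suc l) (λ ())
... | r , eq = suc (3 * r) , trans (cong (3 *_) eq) (triple r)
  where
  triple : ∀ r → 3 * (3 + 6 * r) ≡ 3 + 6 * suc (3 * r)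
  triple = solve-∀

one+three+three : ∀ {x y} → ThreeMod6 x → ThreeMod6 y → OneMod6 (1 + x + y)
one+three+three (r , refl) (s , refl) = suc (r + s) , sum r s
  where
  sum : ∀ r s → 1 + (3 + 6 * r) + (3 + 6 * s) ≡ suc (suc (r + s) * 6)
  sum = solve-∀

exponent≡1mod6 : ∀ l₁ l₂ l₃ → ExactlyOneZero l₁ l₂ l₃ → OneMod6 (3 ^ l₁ + 3 ^ l₂ + 3 ^ l₃)
exponent≡1mod6 _ l₂ l₃ (inj₁ (refl , l₂≢0 , l₃≢0)) =
  one+three+three (pow3≡3mod6 l₂ l₂≢0) (pow3≡3mod6 l₃ l₃≢0)
exponent≡1mod6 l₁ _ l₃ (inj₂ (inj₁ (l₁≢0 , refl , l₃≢0)))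
  with one+three+three (pow3≡3mod6 l₁ l₁≢0) (pow3≡3mod6 l₃ l₃≢0)
... | q , eq = q , trans (cong (_+ 3 ^ l₃) (ℕP.+-comm (3 ^ l₁) 1)) eq
exponent≡1mod6 l₁ l₂ _ (inj₂ (inj₂ (l₁≢0 , l₂≢0 , refl)))
  with one+three+three (pow3≡3mod6 l₁ l₁≢0) (pow3≡3mod6 l₂ l₂≢0)
... | q , eq = q , trans (trans (ℕP.+-comm (3 ^ l₁ + 3 ^ l₂) 1) (sym (ℕP.+-assoc 1 (3 ^ l₁) (3 ^ l₂)))) eq

module FiniteSums {a ℓ} (G : AbelianGroup a ℓ) where
  open AbelianGroup G
    using (Carrier; _≈_; setoid; ∙-cong; ∙-congˡ; assoc; identityˡ; identityʳ; commutativeSemigroup)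
    renaming (_∙_ to _+ᴳ_; ε to 0ᴳ; _⁻¹ to -ᴳ_; refl to ≈-refl; sym to ≈-sym; trans to ≈-trans)
  open import Algebra.Properties.AbelianGroup G using (ε⁻¹≈ε; ⁻¹-∙-comm)
  open import Algebra.Properties.CommutativeSemigroup commutativeSemigroup
    using (interchange)
  open import Relation.Binary.Reasoning.Setoid setoid

  Σ< : (ℕ → Carrier) → ℕ → Carrier
  Σ< g zero    = 0ᴳ
  Σ< g (suc m) = g 0 +ᴳ Σ< (g ∘ suc) m

  fold-applyUpTo : ∀ (g : ℕ → Carrier) (f : ℕ → ℕ) m →
    foldr _+ᴳ_ 0ᴳ (map g (applyUpTo f m)) ≡ Σ< (g ∘ f) m
  fold-applyUpTo g f zero    = refl
  fold-applyUpTo g f (suc m) = cong (g (f 0) +ᴳ_) (fold-applyUpTo g (f ∘ suc) m)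

  Σ<-cong : ∀ {g h} m → (∀ i → g i ≈ h i) → Σ< g m ≈ Σ< h m
  Σ<-cong zero    g≈h = ≈-refl
  Σ<-cong (suc m) g≈h = ∙-cong (g≈h 0) (Σ<-cong m (g≈h ∘ suc))

  Σ<-snoc : ∀ g m → Σ< g (suc m) ≈ Σ< g m +ᴳ g m
  Σ<-snoc g zero    = ≈-trans (identityʳ (g 0)) (≈-sym (identityˡ (g 0)))
  Σ<-snoc g (suc m) = begin
    g 0 +ᴳ Σ< (g ∘ suc) (suc m)        ≈⟨ ∙-congˡ (Σ<-snoc (g ∘ suc) m) ⟩
    g 0 +ᴳ (Σ< (g ∘ suc) m +ᴳ g (suc m)) ≈⟨ assoc _ _ _ ⟨
    Σ< g (suc m) +ᴳ g (suc m)          ∎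

  Σ<-+ : ∀ g h m → Σ< (λ i → g i +ᴳ h i) m ≈ Σ< g m +ᴳ Σ< h m
  Σ<-+ g h zero    = ≈-sym (identityˡ 0ᴳ)
  Σ<-+ g h (suc m) =
    ≈-trans (∙-congˡ (Σ<-+ (g ∘ suc) (h ∘ suc) m)) (interchange _ _ _ _)

  Σ<-neg : ∀ g m → Σ< (λ i → -ᴳ g i) m ≈ -ᴳ Σ< g m
  Σ<-neg g zero    = ≈-sym ε⁻¹≈ε
  Σ<-neg g (suc m) = ≈-trans (∙-congˡ (Σ<-neg (g ∘ suc) m)) (⁻¹-∙-comm _ _)

  Σ<-zero : ∀ g m → (∀ i → g i ≈ 0ᴳ) → Σ< g m ≈ 0ᴳ
  Σ<-zero g zero    g≈0 = ≈-refl
  Σ<-zero g (suc m) g≈0 =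
    ≈-trans (∙-cong (g≈0 0) (Σ<-zero (g ∘ suc) m (g≈0 ∘ suc))) (identityˡ 0ᴳ)

  Σ<-vanishing-tail : ∀ g m j → (∀ i → m ≤ i → g i ≈ 0ᴳ) → Σ< g (j + m) ≈ Σ< g m
  Σ<-vanishing-tail g m zero    g≈0 = ≈-refl
  Σ<-vanishing-tail g m (suc j) g≈0 = begin
    Σ< g (suc (j + m))         ≈⟨ Σ<-snoc g (j + m) ⟩
    Σ< g (j + m) +ᴳ g (j + m)  ≈⟨ ∙-cong (Σ<-vanishing-tail g m j g≈0) (g≈0 (j + m) (ℕP.m≤n+m m j)) ⟩
    Σ< g m +ᴳ 0ᴳ               ≈⟨ identityʳ _ ⟩
    Σ< g m                     ∎

module InField {q : ℕ} (F : FiniteField q) where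
  open FiniteField F using (Carrier; 0#; 1#; 0≢1; isCommutativeRing)
    renaming (_+_ to infixl 6 _⊕_; _*_ to infixl 7 _⊛_; -_ to infix 8 -_)

  field-ring : CommutativeRing 0ℓ 0ℓ
  field-ring = record { isCommutativeRing = isCommutativeRing }

  open CommutativeRing field-ring
    using ( ring; +-abelianGroup; +-assoc; +-comm; +-identityˡ; +-identityʳ; -‿inverseʳ
          ; *-identityʳ; distribʳ; zeroˡ; zeroʳ)
  open import Algebra.Properties.Ring ring using (-‿distribʳ-*; -0#≈0#; -‿involutive; -1*x≈-x)
  open FiniteSums +-abelianGroup
  open ≡-Reasoning

  ι : ℕ → Carrier
  ι = ℕ→F F

  ι-+ : ∀ m n → ι (m + n) ≡ ι m ⊕ ι n
  ι-+ zero    n = sym (+-identityˡ (ι n))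
  ι-+ (suc m) n = trans (cong (1# ⊕_) (ι-+ m n)) (sym (+-assoc 1# (ι m) (ι n)))

  term : ℕ → ℕ → Carrier
  term n i = ι ((n ∸ i) C i) ⊛ pow F (- 1#) i

  term-zero : ∀ n → term n 0 ≡ 1#
  term-zero n = trans (*-identityʳ (1# ⊕ 0#)) (+-identityʳ 1#)

  term-vanishes : ∀ n i → (n ∸ i) C i ≡ 0 → term n i ≡ 0#
  term-vanishes n i C≡0 rewrite C≡0 = zeroˡ (pow F (- 1#) i)

  term-beyond : ∀ n i → n < i → term n i ≡ 0#
  term-beyond n i n<i = term-vanishes n i (begin
    (n ∸ i) C i ≡⟨ cong (_C i) (ℕP.m≤n⇒m∸n≡0 (ℕP.<⇒≤ n<i)) ⟩
    0 C i       ≡⟨ k>n⇒nCk≡0 (ℕP.≤-<-trans z≤n n<i) ⟩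
    0           ∎)

  term-pascal : ∀ n i → term (suc (suc n)) (suc i) ≡ term (suc n) (suc i) ⊕ - term n i
  term-pascal n i = begin
    ι ((suc n ∸ i) C suc i) ⊛ σ       ≡⟨ cong (λ c → ι c ⊛ σ) (pascal-diagonal n i i ℕP.≤-refl) ⟩
    ι (cX + cY) ⊛ σ                    ≡⟨ cong (_⊛ σ) (ι-+ cX cY) ⟩
    (ι cX ⊕ ι cY) ⊛ σ                  ≡⟨ distribʳ σ (ι cX) (ι cY) ⟩
    ι cX ⊛ σ ⊕ ι cY ⊛ σ                ≡⟨ +-comm (ι cX ⊛ σ) (ι cY ⊛ σ) ⟩
    ι cY ⊛ σ ⊕ ι cX ⊛ σ                ≡⟨ cong (ι cY ⊛ σ ⊕_) (cong (ι cX ⊛_) (-1*x≈-x s)) ⟩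
    ι cY ⊛ σ ⊕ ι cX ⊛ (- s)            ≡⟨ cong (ι cY ⊛ σ ⊕_) (sym (-‿distribʳ-* (ι cX) s)) ⟩
    ι cY ⊛ σ ⊕ - (ι cX ⊛ s)            ∎
    where
    s  = pow F (- 1#) i
    σ  = - 1# ⊛ s
    cX = (n ∸ i) C i
    cY = (n ∸ i) C suc i

  E : ℕ → Carrier
  E n = Σ< (term n) (suc n)

  E-extend : ∀ n → Σ< (term n) (suc (suc n)) ≡ E n
  E-extend n = begin
    Σ< (term n) (suc (suc n))  ≡⟨ Σ<-snoc (term n) (suc n) ⟩
    E n ⊕ term n (suc n)       ≡⟨ cong (E n ⊕_) (term-beyond n (suc n) (ℕP.n<1+n n)) ⟩
    E n ⊕ 0#                   ≡⟨ +-identityʳ (E n) ⟩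
    E n                        ∎

  E-rec : ∀ n → E (suc (suc n)) ≡ E (suc n) ⊕ - E n
  E-rec n = begin
    term n₂ 0 ⊕ Σ< (term n₂ ∘ suc) (suc n₁)
      ≡⟨ cong₂ _⊕_ (term-zero n₂) (Σ<-cong (suc n₁) (term-pascal n)) ⟩
    1# ⊕ Σ< (λ i → term n₁ (suc i) ⊕ - term n i) (suc n₁)
      ≡⟨ cong (1# ⊕_) (Σ<-+ (term n₁ ∘ suc) (λ i → - term n i) (suc n₁)) ⟩
    1# ⊕ (Σ< (term n₁ ∘ suc) (suc n₁) ⊕ Σ< (λ i → - term n i) (suc n₁))
      ≡⟨ sym (+-assoc 1# _ _) ⟩
    (1# ⊕ Σ< (term n₁ ∘ suc) (suc n₁)) ⊕ Σ< (λ i → - term n i) (suc n₁)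
      ≡⟨ cong₂ _⊕_ (cong (_⊕ Σ< (term n₁ ∘ suc) (suc n₁)) (sym (term-zero n₁)))
                   (Σ<-neg (term n) (suc n₁)) ⟩
    Σ< (term n₁) (suc (suc n₁)) ⊕ - Σ< (term n) (suc n₁)
      ≡⟨ cong₂ (λ u v → u ⊕ - v) (E-extend n₁) (E-extend n) ⟩
    E n₁ ⊕ - E n
      ∎
    where
    n₁ = suc n
    n₂ = suc n₁

  E-antiperiodic : ∀ n → E (3 + n) ≡ - E n
  E-antiperiodic n = begin
    E (3 + n)                          ≡⟨ E-rec (suc n) ⟩
    E (2 + n) ⊕ - E (1 + n)            ≡⟨ cong (_⊕ - E (1 + n)) (E-rec n) ⟩
    (E (1 + n) ⊕ - E n) ⊕ - E (1 + n)  ≡⟨ cong (_⊕ - E (1 + n)) (+-comm (E (1 + n)) (- E n)) ⟩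
    (- E n ⊕ E (1 + n)) ⊕ - E (1 + n)  ≡⟨ +-assoc (- E n) (E (1 + n)) (- E (1 + n)) ⟩
    - E n ⊕ (E (1 + n) ⊕ - E (1 + n))  ≡⟨ cong (- E n ⊕_) (-‿inverseʳ (E (1 + n))) ⟩
    - E n ⊕ 0#                         ≡⟨ +-identityʳ (- E n) ⟩
    - E n                              ∎

  E-periodic : ∀ n → E (6 + n) ≡ E n
  E-periodic n = begin
    E (6 + n)   ≡⟨ E-antiperiodic (3 + n) ⟩
    - E (3 + n) ≡⟨ cong -_ (E-antiperiodic n) ⟩
    - - E n     ≡⟨ -‿involutive (E n) ⟩
    E n         ∎

  E-one : E 1 ≡ 1#
  E-one = begin
    term 1 0 ⊕ (term 1 1 ⊕ 0#) ≡⟨ cong₂ (λ u v → u ⊕ (v ⊕ 0#)) (term-zero 1) (term-vanishes 1 1 refl) ⟩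
    1# ⊕ (0# ⊕ 0#)             ≡⟨ cong (1# ⊕_) (+-identityˡ 0#) ⟩
    1# ⊕ 0#                    ≡⟨ +-identityʳ 1# ⟩
    1#                         ∎

  E-1mod6 : ∀ k → E (suc (k * 6)) ≡ 1#
  E-1mod6 zero    = E-one
  E-1mod6 (suc k) = trans (E-periodic (suc (k * 6))) (E-1mod6 k)

  coeff-k≡1 : ∀ n i → ℤ→F F (coeff F n 1 i) ≡ ι ((n ∸ i) C i)
  coeff-k≡1 n zero    = refl
  coeff-k≡1 n (suc j) = cong (ℤ→F F) (ℤP.+-identityʳ (ℤ.+ ((n ∸ suc j) C suc j)))

  D-explicit : ∀ m x →
    D F (suc m) 1 x ≡ Σ< (λ i → ι ((suc m ∸ i) C i) ⊛ pow F (- x) i) (suc (suc m / 2))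
  D-explicit m x = trans (fold-applyUpTo _ (λ i → i) (suc (suc m / 2)))
    (Σ<-cong (suc (suc m / 2)) (λ i → cong (_⊛ pow F (- x) i) (coeff-k≡1 (suc m) i)))

  -- D_{n,1}(1,1) = E n: the terms with n/2 < i ≤ n all vanish.
  D-at-one : ∀ m → D F (suc m) 1 1# ≡ E (suc m)
  D-at-one m = begin
    D F n 1 1#                              ≡⟨ D-explicit m 1# ⟩
    Σ< (term n) (suc (n / 2))               ≡⟨ sym (Σ<-vanishing-tail (term n) (suc (n / 2)) (n ∸ n / 2) beyond) ⟩
    Σ< (term n) (n ∸ n / 2 + suc (n / 2))   ≡⟨ cong (Σ< (term n)) length ⟩
    E n                                     ∎
    where
    n = suc m
    beyond : ∀ i → suc (n / 2) ≤ i → term n i ≡ 0#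
    beyond i half<i = term-vanishes n i (k>n⇒nCk≡0 (beyond-half n i half<i))
    length : n ∸ n / 2 + suc (n / 2) ≡ suc n
    length = trans (ℕP.+-suc (n ∸ n / 2) (n / 2)) (cong suc (ℕP.m∸n+n≡m (m/n≤m n 2)))

  D-at-zero : ∀ m → D F (suc m) 1 0# ≡ 1#
  D-at-zero m = begin
    D F (suc m) 1 0#                       ≡⟨ D-explicit m 0# ⟩
    g 0 ⊕ Σ< (g ∘ suc) (suc m / 2)         ≡⟨ cong₂ _⊕_ (term-zero 0) (Σ<-zero (g ∘ suc) (suc m / 2) higher) ⟩
    1# ⊕ 0#                                ≡⟨ +-identityʳ 1# ⟩
    1#                                     ∎
    where
    g : ℕ → Carrier
    g i = ι ((suc m ∸ i) C i) ⊛ pow F (- 0#) i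
    higher : ∀ i → g (suc i) ≡ 0#
    higher i = begin
      ι c ⊛ (- 0# ⊛ pow F (- 0#) i)  ≡⟨ cong (λ z → ι c ⊛ (z ⊛ pow F (- 0#) i)) -0#≈0# ⟩
      ι c ⊛ (0# ⊛ pow F (- 0#) i)    ≡⟨ cong (ι c ⊛_) (zeroˡ (pow F (- 0#) i)) ⟩
      ι c ⊛ 0#                       ≡⟨ zeroʳ (ι c) ⟩
      0#                             ∎
      where c = (suc m ∸ suc i) C suc i

  D-not-permutation : ∀ k → ¬ IsPermutation F (D F (suc (k * 6)) 1)
  D-not-permutation k (injective , _) = 0≢1 (injective (begin
    D F (suc (k * 6)) 1 0#   ≡⟨ D-at-zero (k * 6) ⟩
    1#                       ≡⟨ sym (E-1mod6 k) ⟩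
    E (suc (k * 6))          ≡⟨ sym (D-at-one (k * 6)) ⟩
    D F (suc (k * 6)) 1 1#   ∎))

mainTheorem10 : (e : ℕ) → 1 ≤ e → (F : FiniteField (3 ^ e))
    → (l₁ l₂ l₃ : ℕ) → ExactlyOneZero l₁ l₂ l₃
    → ¬ IsPermutation F (D F (3 ^ l₁ + 3 ^ l₂ + 3 ^ l₃) 1)
mainTheorem10 _ _ F l₁ l₂ l₃ exactlyOneZero
  with exponent≡1mod6 l₁ l₂ l₃ exactlyOneZero
... | k , n≡6k+1 rewrite n≡6k+1 = InField.D-not-permutation F k
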